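{- For every integer $\ell\ge 3$, every graph that has no induced cycle of length at least $\ell$ has cop number at most $\ell-2$.
   Context: All graphs are finite, simple and undirected. The game of Cops and Robber on a connected graph: the cop player places $k\ge 1$ cops on vertices (not necessarily distinct), then the robber chooses a vertex; then, starting with the cops, the players alternate moves, where in the cops' move each cop either stays or moves to an adjacent vertex, and in the robber's move the robber either stays or moves to an adjacent vertex. The cops win if at some point a cop and the robber occupy the same vertex; both players have complete information. The cop number of a connected graph is the least $k$ such that $k$ cops have a winning strategy; for a disconnected graph it is the maximum cop number of its connected components. -}

module Defs where

open import Data.Nat using (ℕ; zero; suc; _≤_)
open import Data.Fin using (Fin; toℕ)
open import Data.Product using (Σ; ∃; _×_; _,_)
open import Data.Sum using (_⊎_)
open import Relation.Nullary using (¬_; Dec)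
open import Relation.Binary.PropositionalEquality using (_≡_)
open import Function.Definitions using (Injective)
open import Function.Bundles using (_⇔_)

record Graph (n : ℕ) : Set₁ where
  field
    _∼_    : Fin n → Fin n → Set
    sym    : ∀ {x y} → x ∼ y → y ∼ x
    irrefl : ∀ {x} → ¬ (x ∼ x)
    dec    : ∀ x y → Dec (x ∼ y)

open Graph public

CycSucc : (k : ℕ) → Fin k → Fin k → Set
CycSucc k i j = (suc (toℕ i) ≡ toℕ j) ⊎ ((suc (toℕ i) ≡ k) × (toℕ j ≡ 0))

record InducedCycle {n : ℕ} (G : Graph n) (k : ℕ) : Set where
  field
    length≥3 : 3 ≤ k
    c        : Fin k → Fin n
    inj      : Injective _≡_ _≡_ c
    adj      : ∀ i j → (_∼_ G (c i) (c j)) ⇔ (CycSucc k i j ⊎ CycSucc k j i)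

Step : {n : ℕ} → Graph n → Fin n → Fin n → Set
Step G a b = (a ≡ b) ⊎ _∼_ G a b

Cops : ℕ → ℕ → Set
Cops n k = Fin k → Fin n

CopStep : {n k : ℕ} → Graph n → Cops n k → Cops n k → Set
CopStep G cs cs' = ∀ i → Step G (cs i) (cs' i)

Caught : {n k : ℕ} → Cops n k → Fin n → Set
Caught {k = k} cs r = ∃ λ (i : Fin k) → cs i ≡ r

-- CopsForce G cs r : the cops, at positions cs and to move, with the robber
-- at r, have a strategy that guarantees capture after finitely many rounds
-- (least fixed point, i.e. the cops' attractor of the finite game).
data CopsForce {n k : ℕ} (G : Graph n) (cs : Cops n k) (r : Fin n) : Set where
  move : (cs' : Cops n k) → CopStep G cs cs' →
         (Caught cs' r ⊎
          (∀ r' → Step G r r' → Caught cs' r' ⊎ CopsForce G cs' r')) →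
         CopsForce G cs r

data Reach {n : ℕ} (G : Graph n) (v : Fin n) : Fin n → Set where
  here : Reach G v v
  step : ∀ {u w} → Reach G v u → _∼_ G u w → Reach G v w

-- k cops win the game played on the connected component of v
-- (cops are placed in the component, then the robber picks a vertex there;
-- moves automatically stay inside the component).
CopsWinOnComponent : {n : ℕ} → Graph n → ℕ → Fin n → Set
CopsWinOnComponent {n} G k v =
  Σ (Cops n k) λ cs → (∀ i → Reach G v (cs i)) ×
    (∀ r → Reach G v r → Caught cs r ⊎ CopsForce G cs r)

CopNumber≤ : {n : ℕ} → Graph n → ℕ → Set
CopNumber≤ {n} G m =
  ∀ (v : Fin n) → ∃ λ k → (1 ≤ k) × (k ≤ m) × CopsWinOnComponent G k v

-- Let m = ℓ - 2. The cops stand on an induced path p 0, …, p e with e < m, and the robber is confined to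
-- his territory R, the component of G − N[p 0, …, p e] containing him; every exit of R (a vertex outside R
-- with a neighbour in R) is then adjacent to the path. If all exits are adjacent to p 1, …, p e, the cops
-- drop p 0, keeping R and shortening the path; symmetrically for p e. Otherwise some exit x is adjacent
-- only to p 0 and some exit y only to p e. If e + 1 < m the path is extended by y, which strictly shrinks
-- R. If e + 1 = m, an induced path from y to x through R closes with the cop path an induced cycle of
-- length at least m + 2 = ℓ, which does not exist. On a one-vertex path the cops extend to an exit when
-- m > 1; when m = 1 two exits would again close a long cycle, so the lone cop steps onto the unique exit.
-- Every round decreases (|R|, e) lexicographically, so the robber is eventually caught.

module Submission where

open import Defs
open import Data.Nat using (ℕ; zero; suc; _+_; _∸_; _≤_; _<_; _⊓_; z≤n; s≤s; s≤s⁻¹; z<s; _≤?_; _<?_)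
open import Data.Nat.Properties
open import Data.Nat.Induction using (<-wellFounded)
open import Induction.WellFounded using (Acc; acc)
open import Data.Fin using (Fin; toℕ; fromℕ<)
open import Data.Fin.Properties using (any?; toℕ-fromℕ<; toℕ-injective; toℕ<n) renaming (_≟_ to _≟ᶠ_)
open import Data.Fin.Subset using (Subset; _∈_; _∉_; _⊆_; ⁅_⁆; _∪_; ∣_∣)
open import Data.Fin.Subset.Properties
  using (_∈?_; ∣p∣≤n; p⊆q⇒∣p∣≤∣q∣; p⊂q⇒∣p∣<∣q∣; x∈⁅x⁆; x∈⁅y⁆⇒x≡y; x∈p∪q⁺; x∈p∪q⁻; q⊆p∪q)
open import Data.Vec.Functional using (updateAt)
open import Data.Vec.Functional.Properties using (updateAt-updates; updateAt-minimal)
open import Data.Product using (Σ; ∃; _×_; _,_; proj₁; proj₂)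
open import Data.Sum using (_⊎_; inj₁; inj₂; [_,_])
import Data.Sum as Sum
open import Data.Empty using (⊥; ⊥-elim)
open import Relation.Nullary using (¬_; Dec; yes; no; contradiction)
open import Relation.Nullary.Decidable using (map′; _×-dec_; _⊎-dec_; ¬?; decidable-stable)
open import Relation.Unary using (Decidable)
open import Relation.Binary.PropositionalEquality
  using (_≡_; _≢_; refl; trans; cong; subst; subst₂) renaming (sym to ≡-sym)
open import Relation.Binary.Definitions using (tri<; tri≈; tri>)
open import Function.Base using (_∘_; id)
open import Function.Bundles using (mk⇔)
open import Algebra.Properties.CommutativeSemigroup +-commutativeSemigroup using (xy∙z≈xz∙y)

≤-suc-cases : ∀ {a e} → a ≤ suc e → a ≤ e ⊎ a ≡ suc e
≤-suc-cases a≤1+e = Sum.map₁ s≤s⁻¹ (m≤n⇒m<n∨m≡n a≤1+e)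

anyUpTo≤? : ∀ {P : ℕ → Set} → Decidable P → ∀ e → Dec (∃ λ a → a ≤ e × P a)
anyUpTo≤? P? e = map′ (λ (a , a<1+e , pa) → a , s≤s⁻¹ a<1+e , pa)
                      (λ (a , a≤e , pa) → a , s≤s a≤e , pa)
                      (anyUpTo? P? (suc e))

private
  shortcut-length : ∀ a o t → suc (suc a) + o + t ≡ suc (a + t) + suc o
  shortcut-length a o t = cong suc (trans (cong suc (xy∙z≈xz∙y a o t)) (≡-sym (+-suc (a + t) o)))

module _ {n : ℕ} (G : Graph n) where
  open Graph G using () renaming (_∼_ to _~_; sym to ~-sym; irrefl to ~-irrefl; dec to _~?_)

  reach-trans : ∀ {a b c} → Reach G a b → Reach G b c → Reach G a c
  reach-trans ab here          = ab
  reach-trans ab (step bc c~d) = step (reach-trans ab bc) c~d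

  step⇒reach : ∀ {a b} → Step G a b → Reach G a b
  step⇒reach (inj₁ refl) = here
  step⇒reach (inj₂ a~b)  = step here a~b

  reach-leaves : ∀ {Q : Fin n → Set} → Decidable Q → ∀ {a b} → Reach G a b → ¬ Q a → Q b →
                 ∃ λ z → ¬ Q z × ∃ λ c → Q c × c ~ z
  reach-leaves Q? here ¬Qa Qa = contradiction Qa ¬Qa
  reach-leaves Q? (step {u} ab u~b) ¬Qa Qb with Q? u
  ... | yes Qu = reach-leaves Q? ab ¬Qa Qu
  ... | no ¬Qu = u , ¬Qu , _ , Qb , ~-sym u~b

  data Walk (P : Fin n → Set) : Fin n → Fin n → Set where
    nil  : ∀ {a} → P a → Walk P a a
    cons : ∀ {a b c} → P a → a ~ b → Walk P b c → Walk P a c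

  module _ {P : Fin n → Set} where
    walk-head : ∀ {a b} → Walk P a b → P a
    walk-head (nil Pa)      = Pa
    walk-head (cons Pa _ _) = Pa

    walk-++ : ∀ {a b c} → Walk P a b → Walk P b c → Walk P a c
    walk-++ (nil _)         W′ = W′
    walk-++ (cons Pa a~b W) W′ = cons Pa a~b (walk-++ W W′)

    walk-reverse : ∀ {a b} → Walk P a b → Walk P b a
    walk-reverse (nil Pa)        = nil Pa
    walk-reverse (cons Pa a~b W) = walk-++ (walk-reverse W) (cons (walk-head W) (~-sym a~b) (nil Pa))

    walk-map : ∀ {Q : Fin n → Set} → (∀ {x} → P x → Q x) → ∀ {a b} → Walk P a b → Walk Q a b
    walk-map f (nil Pa)        = nil (f Pa)
    walk-map f (cons Pa a~b W) = cons (f Pa) a~b (walk-map f W)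

    walk-stays : ∀ {Q : Fin n → Set} → (∀ {b a} → Q b → b ~ a → P a → Q a) →
                 ∀ {a b} → Walk P a b → Q b → Q a
    walk-stays absorb (nil _)         Qb = Qb
    walk-stays absorb (cons Pa a~b W) Qc = absorb (walk-stays absorb W Qc) (~-sym a~b) Pa

  record IsInduced (s : ℕ) (w : ℕ → Fin n) : Set where
    field
      injective : ∀ {a b} → a ≤ s → b ≤ s → w a ≡ w b → a ≡ b
      chordless : ∀ {a b} → a ≤ s → b ≤ s → w a ~ w b → suc a ≡ b ⊎ suc b ≡ a

  record IsInducedPath (s : ℕ) (w : ℕ → Fin n) : Set where
    field
      consecutive : ∀ {a} → a < s → w a ~ w (suc a)
      isInduced   : IsInduced s w
    open IsInduced isInduced public

  singleton-path : ∀ v → IsInducedPath 0 (λ _ → v)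
  singleton-path v = record
    { consecutive = λ ()
    ; isInduced   = record
      { injective = λ a≤0 b≤0 _ → trans (n≤0⇒n≡0 a≤0) (≡-sym (n≤0⇒n≡0 b≤0))
      ; chordless = λ _ _ v~v → contradiction v~v ~-irrefl } }

  append : ℕ → (ℕ → Fin n) → Fin n → ℕ → Fin n
  append e p y k with k ≤? e
  ... | yes _ = p k
  ... | no _  = y

  append-≤ : ∀ {e p y k} → k ≤ e → append e p y k ≡ p k
  append-≤ {e} {k = k} k≤e with k ≤? e
  ... | yes _   = refl
  ... | no k≰e = contradiction k≤e k≰e

  append-last : ∀ {e p y} → append e p y (suc e) ≡ y
  append-last {e} with suc e ≤? e
  ... | yes 1+e≤e = contradiction 1+e≤e (n≮n e)
  ... | no _      = refl

  append-path : ∀ {e p y} → IsInducedPath e p → y ~ p e →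
                (∀ {a} → a ≤ e → y ≢ p a) → (∀ {a} → a < e → ¬ y ~ p a) →
                IsInducedPath (suc e) (append e p y)
  append-path {e} {p} {y} P y~pe y∉p y≁p = record
    { consecutive = consecutive′
    ; isInduced   = record { injective = injective′ ; chordless = chordless′ } }
    where
      open IsInducedPath P
      p′ : ℕ → Fin n
      p′ = append e p y
      p′-≤ : ∀ {k} → k ≤ e → p′ k ≡ p k
      p′-≤ = append-≤ {e} {p} {y}
      p′-last : p′ (suc e) ≡ y
      p′-last = append-last {e} {p} {y}

      y~only-pe : ∀ {a} → a ≤ e → y ~ p a → a ≡ e
      y~only-pe a≤e y~pa = [ (λ a<e → contradiction y~pa (y≁p a<e)) , id ] (m≤n⇒m<n∨m≡n a≤e)

      consecutive′ : ∀ {a} → a < suc e → p′ a ~ p′ (suc a)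
      consecutive′ {a} a<1+e with m≤n⇒m<n∨m≡n (s≤s⁻¹ a<1+e)
      ... | inj₁ a<e  = subst₂ _~_ (≡-sym (p′-≤ (<⇒≤ a<e))) (≡-sym (p′-≤ a<e)) (consecutive a<e)
      ... | inj₂ refl = subst₂ _~_ (≡-sym (p′-≤ ≤-refl)) (≡-sym p′-last) (~-sym y~pe)

      injective′ : ∀ {a b} → a ≤ suc e → b ≤ suc e → p′ a ≡ p′ b → a ≡ b
      injective′ {a} {b} a≤ b≤ eq with ≤-suc-cases a≤ | ≤-suc-cases b≤
      ... | inj₁ a≤e  | inj₁ b≤e  = injective a≤e b≤e (trans (≡-sym (p′-≤ a≤e)) (trans eq (p′-≤ b≤e)))
      ... | inj₁ a≤e  | inj₂ refl = contradiction (trans (≡-sym p′-last) (trans (≡-sym eq) (p′-≤ a≤e))) (y∉p a≤e)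
      ... | inj₂ refl | inj₁ b≤e  = contradiction (trans (≡-sym p′-last) (trans eq (p′-≤ b≤e))) (y∉p b≤e)
      ... | inj₂ refl | inj₂ refl = refl

      chordless′ : ∀ {a b} → a ≤ suc e → b ≤ suc e → p′ a ~ p′ b → suc a ≡ b ⊎ suc b ≡ a
      chordless′ {a} {b} a≤ b≤ pa~pb with ≤-suc-cases a≤ | ≤-suc-cases b≤
      ... | inj₁ a≤e  | inj₁ b≤e  = chordless a≤e b≤e (subst₂ _~_ (p′-≤ a≤e) (p′-≤ b≤e) pa~pb)
      ... | inj₁ a≤e  | inj₂ refl = inj₁ (cong suc (y~only-pe a≤e (~-sym (subst₂ _~_ (p′-≤ a≤e) p′-last pa~pb))))
      ... | inj₂ refl | inj₁ b≤e  = inj₂ (cong suc (y~only-pe b≤e (subst₂ _~_ p′-last (p′-≤ b≤e) pa~pb)))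
      ... | inj₂ refl | inj₂ refl = contradiction pa~pb ~-irrefl

  init-path : ∀ {e p} → IsInducedPath (suc e) p → IsInducedPath e p
  init-path P = record
    { consecutive = λ a<e → consecutive (m<n⇒m<1+n a<e)
    ; isInduced   = record
      { injective = λ a≤e b≤e → injective (m≤n⇒m≤1+n a≤e) (m≤n⇒m≤1+n b≤e)
      ; chordless = λ a≤e b≤e → chordless (m≤n⇒m≤1+n a≤e) (m≤n⇒m≤1+n b≤e) } }
    where open IsInducedPath P

  tail-path : ∀ {e p} → IsInducedPath (suc e) p → IsInducedPath e (p ∘ suc)
  tail-path P = record
    { consecutive = λ a<e → consecutive (s≤s a<e)
    ; isInduced   = record
      { injective = λ a≤e b≤e pa≡pb → suc-injective (injective (s≤s a≤e) (s≤s b≤e) pa≡pb)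
      ; chordless = λ a≤e b≤e pa~pb → Sum.map suc-injective suc-injective (chordless (s≤s a≤e) (s≤s b≤e) pa~pb) } }
    where open IsInducedPath P

  record WalkVia (P : Fin n → Set) (y x : Fin n) : Set where
    field
      length      : ℕ
      vertex      : ℕ → Fin n
      start       : vertex 0 ≡ y
      end         : vertex length ≡ x
      consecutive : ∀ {a} → a < length → vertex a ~ vertex (suc a)
      inner       : ∀ {a} → 0 < a → a < length → P (vertex a)

  module _ {P : Fin n → Set} where
    edge-via : ∀ {y x} → y ~ x → WalkVia P y x
    edge-via {y} {x} y~x = record
      { length = 1 ; vertex = λ { zero → y ; (suc _) → x } ; start = refl ; end = refl
      ; consecutive = λ { {zero} _ → y~x ; {suc _} (s≤s ()) } ; inner = λ { {suc _} _ (s≤s ()) } }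

    cons-via : ∀ {y a x} → y ~ a → P a → WalkVia P a x → WalkVia P y x
    cons-via {y} y~a Pa W = record
      { length = suc length ; vertex = λ { zero → y ; (suc k) → vertex k } ; start = refl ; end = end
      ; consecutive = λ { {zero} _ → subst (y ~_) (≡-sym start) y~a ; {suc _} a<s → consecutive (s≤s⁻¹ a<s) }
      ; inner = λ { {suc zero} _ _ → subst P (≡-sym start) Pa ; {suc (suc _)} _ a<s → inner z<s (s≤s⁻¹ a<s) } }
      where open WalkVia W

    walk-via : ∀ {y a b x} → y ~ a → Walk P a b → b ~ x → WalkVia P y x
    walk-via y~a (nil Pa)          a~x = cons-via y~a Pa (edge-via a~x)
    walk-via y~a (cons Pa a~a′ W) b~x = cons-via y~a Pa (walk-via a~a′ W b~x)

  Defect : (ℕ → Fin n) → ℕ → ℕ → Set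
  Defect w a b = (suc a < b × w a ~ w b) ⊎ (a < b × w a ≡ w b)

  defect? : ∀ w a b → Dec (Defect w a b)
  defect? w a b = (suc a <? b ×-dec (w a ~? w b)) ⊎-dec (a <? b ×-dec (w a ≟ᶠ w b))

  defect-free⇒induced : ∀ {s w} → ¬ (∃ λ a → a ≤ s × ∃ λ b → b ≤ s × Defect w a b) → IsInduced s w
  defect-free⇒induced {s} {w} none = record { injective = injective ; chordless = chordless }
    where
      injective : ∀ {a b} → a ≤ s → b ≤ s → w a ≡ w b → a ≡ b
      injective {a} {b} a≤s b≤s wa≡wb with <-cmp a b
      ... | tri< a<b _ _ = contradiction (a , a≤s , b , b≤s , inj₂ (a<b , wa≡wb)) none
      ... | tri≈ _ a≡b _ = a≡b
      ... | tri> _ _ b<a = contradiction (b , b≤s , a , a≤s , inj₂ (b<a , ≡-sym wa≡wb)) none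

      chordless : ∀ {a b} → a ≤ s → b ≤ s → w a ~ w b → suc a ≡ b ⊎ suc b ≡ a
      chordless {a} {b} a≤s b≤s wa~wb with <-cmp a b
      ... | tri< a<b _ _  = [ (λ 1+a<b → contradiction (a , a≤s , b , b≤s , inj₁ (1+a<b , wa~wb)) none)
                            , inj₁ ] (m≤n⇒m<n∨m≡n a<b)
      ... | tri≈ _ refl _ = contradiction wa~wb ~-irrefl
      ... | tri> _ _ b<a  = [ (λ 1+b<a → contradiction (b , b≤s , a , a≤s , inj₁ (1+b<a , ~-sym wa~wb)) none)
                            , inj₂ ] (m≤n⇒m<n∨m≡n b<a)

  module _ {P : Fin n → Set} {y x : Fin n} where
    open WalkVia

    skip : (ℕ → Fin n) → ℕ → ℕ → ℕ → Fin n
    skip w a d k with k ≤? a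
    ... | yes _ = w k
    ... | no _  = w (k + d)

    skip-≤ : ∀ w a d {k} → k ≤ a → skip w a d k ≡ w k
    skip-≤ w a d {k} k≤a with k ≤? a
    ... | yes _   = refl
    ... | no k≰a = contradiction k≤a k≰a

    skip-> : ∀ w a d {k} → a < k → skip w a d k ≡ w (k + d)
    skip-> w a d {k} a<k with k ≤? a
    ... | yes k≤a = contradiction k≤a (<⇒≱ a<k)
    ... | no _    = refl

    -- Removes the suc d positions following a, bridging them by the edge from a to suc a + suc d.
    shortcut : (W : WalkVia P y x) {a s d : ℕ} → length W ≡ s + suc d → a < s →
               vertex W a ~ vertex W (suc a + suc d) → Σ (WalkVia P y x) λ W′ → length W′ < length W
    shortcut W {a} {s} {d} len≡ a<s jump = W′ , subst (s <_) (≡-sym len≡) (m<m+n s z<s)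
      where
        w w′ : ℕ → Fin n
        w = vertex W
        w′ = skip w a (suc d)

        a<len : a < length W
        a<len = <-≤-trans a<s (subst (s ≤_) (≡-sym len≡) (m≤m+n s (suc d)))

        shifted< : ∀ {k} → k < s → k + suc d < length W
        shifted< k<s = subst (_ <_) (≡-sym len≡) (+-monoˡ-< (suc d) k<s)

        consecutive′ : ∀ {k} → k < s → w′ k ~ w′ (suc k)
        consecutive′ {k} k<s with <-cmp k a
        ... | tri< k<a _ _  = subst₂ _~_ (≡-sym (skip-≤ w a (suc d) (<⇒≤ k<a))) (≡-sym (skip-≤ w a (suc d) k<a))
                                     (consecutive W (<-trans k<a a<len))
        ... | tri≈ _ refl _ = subst₂ _~_ (≡-sym (skip-≤ w a (suc d) ≤-refl)) (≡-sym (skip-> w a (suc d) ≤-refl)) jump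
        ... | tri> _ _ a<k  = subst₂ _~_ (≡-sym (skip-> w a (suc d) a<k)) (≡-sym (skip-> w a (suc d) (m<n⇒m<1+n a<k)))
                                     (consecutive W (shifted< k<s))

        inner′ : ∀ {k} → 0 < k → k < s → P (w′ k)
        inner′ {k} 0<k k<s with ≤-<-connex k a
        ... | inj₁ k≤a = subst P (≡-sym (skip-≤ w a (suc d) k≤a)) (inner W 0<k (≤-<-trans k≤a a<len))
        ... | inj₂ a<k = subst P (≡-sym (skip-> w a (suc d) a<k))
                               (inner W (<-≤-trans 0<k (m≤m+n k (suc d))) (shifted< k<s))

        W′ : WalkVia P y x
        W′ = record
          { length      = s
          ; vertex      = w′
          ; start       = trans (skip-≤ w a (suc d) z≤n) (start W)
          ; end         = trans (skip-> w a (suc d) a<s) (trans (cong w (≡-sym len≡)) (end W))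
          ; consecutive = consecutive′
          ; inner       = inner′ }

    chord-shortcut : (W : WalkVia P y x) {a b : ℕ} → suc a < b → b ≤ length W → vertex W a ~ vertex W b →
                     Σ (WalkVia P y x) λ W′ → length W′ < length W
    chord-shortcut W {a} 1+a<b b≤len wa~wb
      with o , refl ← m≤n⇒∃[o]m+o≡n 1+a<b
      with t , b+t≡len ← m≤n⇒∃[o]m+o≡n b≤len
      = shortcut W (trans (≡-sym b+t≡len) (shortcut-length a o t)) (s≤s (m≤m+n a t))
                 (subst (λ i → vertex W a ~ vertex W (suc i)) (≡-sym (+-suc a o)) wa~wb)

    end-unrepeated : (W : WalkVia P y x) → y ≢ x → ¬ P x → ∀ {a} → a < length W → vertex W a ≢ x
    end-unrepeated W y≢x ¬Px {zero}  _     v0≡x = y≢x (trans (≡-sym (start W)) v0≡x)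
    end-unrepeated W y≢x ¬Px {suc a} a<len va≡x = ¬Px (subst P va≡x (inner W z<s a<len))

    shorten : (W : WalkVia P y x) → y ≢ x → ¬ P x → Acc _<_ (length W) →
              Σ (WalkVia P y x) λ W′ → IsInduced (length W′) (vertex W′)
    shorten W y≢x ¬Px (acc rec)
      with anyUpTo≤? (λ a → anyUpTo≤? (defect? (vertex W) a) (length W)) (length W)
    ... | no none = W , defect-free⇒induced none
    ... | yes (a , _ , b , b≤len , inj₁ (1+a<b , wa~wb)) =
          let W′ , shorter = chord-shortcut W 1+a<b b≤len wa~wb in shorten W′ y≢x ¬Px (rec shorter)
    ... | yes (a , _ , b , b≤len , inj₂ (a<b , wa≡wb)) with m≤n⇒m<n∨m≡n b≤len
    ...   | inj₁ b<len =
          let W′ , shorter = chord-shortcut W (s≤s a<b) b<len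
                               (subst (_~ vertex W (suc b)) (≡-sym wa≡wb) (consecutive W b<len))
          in shorten W′ y≢x ¬Px (rec shorter)
    ...   | inj₂ refl = contradiction (trans wa≡wb (end W)) (end-unrepeated W y≢x ¬Px a<b)

    induced-path-via : WalkVia P y x → y ≢ x → ¬ P x →
                       Σ (WalkVia P y x) λ W → IsInducedPath (length W) (vertex W)
    induced-path-via W y≢x ¬Px =
      let W′ , induced = shorten W y≢x ¬Px (<-wellFounded _)
      in W′ , record { consecutive = consecutive W′ ; isInduced = induced }

  module _ {e s : ℕ} {p q : ℕ → Fin n} (P : IsInducedPath e p) (Q : IsInducedPath s q)
           (disjoint : ∀ {a b} → a ≤ e → b ≤ s → p a ≢ q b)
           (only-ends : ∀ {a b} → a ≤ e → b ≤ s → p a ~ q b → (a ≡ e × b ≡ 0) ⊎ (a ≡ 0 × b ≡ s))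
           (pe~q0 : p e ~ q 0) (qs~p0 : q s ~ p 0) (0<s : 0 < s) where

    private
      module P = IsInducedPath P
      module Q = IsInducedPath Q

      K : ℕ
      K = suc e + suc s

      Next : ℕ → ℕ → Set
      Next t t′ = suc t ≡ t′ ⊎ (suc t ≡ K × t′ ≡ 0)

      cycle : ℕ → Fin n
      cycle t with t ≤? e
      ... | yes _ = p t
      ... | no _  = q (t ∸ suc e)

      cycle-p : ∀ {t} → t ≤ e → cycle t ≡ p t
      cycle-p {t} t≤e with t ≤? e
      ... | yes _   = refl
      ... | no t≰e = contradiction t≤e t≰e

      cycle-q : ∀ b → cycle (suc e + b) ≡ q b
      cycle-q b with suc e + b ≤? e
      ... | yes 1+e+b≤e = contradiction 1+e+b≤e (<⇒≱ (s≤s (m≤m+n e b)))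
      ... | no _        = cong q (m+n∸m≡n (suc e) b)

      data Position : ℕ → Set where
        on-p : ∀ {t} → t ≤ e → Position t
        on-q : ∀ {b} → b ≤ s → Position (suc e + b)

      position : ∀ {t} → t < K → Position t
      position {t} t<K with ≤-<-connex t e
      ... | inj₁ t≤e = on-p t≤e
      ... | inj₂ e<t with b , refl ← m≤n⇒∃[o]m+o≡n e<t = on-q (s≤s⁻¹ (+-cancelˡ-< (suc e) b (suc s) t<K))

      last≡ : suc (suc e + s) ≡ K
      last≡ = ≡-sym (+-suc (suc e) s)

      swap : ∀ {t t′} → Next t t′ ⊎ Next t′ t → Next t′ t ⊎ Next t t′
      swap = [ inj₂ , inj₁ ]

      p~q⇒next : ∀ {a b} → a ≤ e → b ≤ s → p a ~ q b → Next a (suc e + b) ⊎ Next (suc e + b) a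
      p~q⇒next a≤e b≤s pa~qb with only-ends a≤e b≤s pa~qb
      ... | inj₁ (refl , refl) = inj₁ (inj₁ (cong suc (≡-sym (+-identityʳ e))))
      ... | inj₂ (refl , refl) = inj₂ (inj₂ (last≡ , refl))

      adjacent⇒next : ∀ {t t′} → t < K → t′ < K → cycle t ~ cycle t′ → Next t t′ ⊎ Next t′ t
      adjacent⇒next t<K t′<K ct~ct′ with position t<K | position t′<K
      ... | on-p t≤e | on-p t′≤e =
            Sum.map inj₁ inj₁ (P.chordless t≤e t′≤e (subst₂ _~_ (cycle-p t≤e) (cycle-p t′≤e) ct~ct′))
      ... | on-p t≤e | on-q {b} b≤s =
            p~q⇒next t≤e b≤s (subst₂ _~_ (cycle-p t≤e) (cycle-q b) ct~ct′)
      ... | on-q {b} b≤s | on-p t′≤e =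
            swap (p~q⇒next t′≤e b≤s (~-sym (subst₂ _~_ (cycle-q b) (cycle-p t′≤e) ct~ct′)))
      ... | on-q {b} b≤s | on-q {b′} b′≤s =
            Sum.map (λ 1+b≡b′ → inj₁ (trans (≡-sym (+-suc (suc e) b)) (cong (suc e +_) 1+b≡b′)))
                    (λ 1+b′≡b → inj₁ (trans (≡-sym (+-suc (suc e) b′)) (cong (suc e +_) 1+b′≡b)))
                    (Q.chordless b≤s b′≤s (subst₂ _~_ (cycle-q b) (cycle-q b′) ct~ct′))

      next⇒adjacent : ∀ {t t′} → t < K → t′ < K → Next t t′ → cycle t ~ cycle t′
      next⇒adjacent t<K 1+t<K (inj₁ refl) with position t<K
      ... | on-p {t} t≤e with m≤n⇒m<n∨m≡n t≤e
      ...   | inj₁ t<e  = subst₂ _~_ (≡-sym (cycle-p t≤e)) (≡-sym (cycle-p t<e)) (P.consecutive t<e)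
      ...   | inj₂ refl = subst₂ _~_ (≡-sym (cycle-p t≤e))
                                   (≡-sym (trans (cong cycle (≡-sym (+-identityʳ (suc e)))) (cycle-q 0))) pe~q0
      next⇒adjacent t<K 1+t<K (inj₁ refl) | on-q {b} b≤s =
        subst₂ _~_ (≡-sym (cycle-q b)) (≡-sym (trans (cong cycle (≡-sym (+-suc (suc e) b))) (cycle-q (suc b))))
               (Q.consecutive (s≤s⁻¹ (+-cancelˡ-< (suc e) (suc b) (suc s)
                                        (subst (_< K) (≡-sym (+-suc (suc e) b)) 1+t<K))))
      next⇒adjacent {t} _ _ (inj₂ (1+t≡K , refl)) =
        subst₂ _~_ (≡-sym (trans (cong cycle (suc-injective (trans 1+t≡K (≡-sym last≡)))) (cycle-q s)))
               (≡-sym (cycle-p z≤n)) qs~p0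

      injective : ∀ {t t′} → t < K → t′ < K → cycle t ≡ cycle t′ → t ≡ t′
      injective t<K t′<K ct≡ct′ with position t<K | position t′<K
      ... | on-p t≤e | on-p t′≤e = P.injective t≤e t′≤e (trans (≡-sym (cycle-p t≤e)) (trans ct≡ct′ (cycle-p t′≤e)))
      ... | on-p t≤e | on-q {b} b≤s =
            contradiction (trans (≡-sym (cycle-p t≤e)) (trans ct≡ct′ (cycle-q b))) (disjoint t≤e b≤s)
      ... | on-q {b} b≤s | on-p t′≤e =
            contradiction (trans (≡-sym (cycle-p t′≤e)) (trans (≡-sym ct≡ct′) (cycle-q b))) (disjoint t′≤e b≤s)
      ... | on-q {b} b≤s | on-q {b′} b′≤s =
            cong (suc e +_) (Q.injective b≤s b′≤s (trans (≡-sym (cycle-q b)) (trans ct≡ct′ (cycle-q b′))))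

    induced-cycle : InducedCycle G (suc e + suc s)
    induced-cycle = record
      { length≥3 = +-mono-≤ {1} {suc e} (s≤s z≤n) (s≤s 0<s)
      ; c        = λ i → cycle (toℕ i)
      ; inj      = λ {i} {j} eq → toℕ-injective (injective (toℕ<n i) (toℕ<n j) eq)
      ; adj      = λ i j → mk⇔ (adjacent⇒next (toℕ<n i) (toℕ<n j)) [ next⇒adjacent (toℕ<n i) (toℕ<n j)
                                                                  , ~-sym ∘ next⇒adjacent (toℕ<n j) (toℕ<n i) ] }

  record ConnectedIn (A : Fin n → Set) (r : Fin n) (C : Subset n) : Set where
    field
      root      : r ∈ C
      ⊆A        : ∀ {z} → z ∈ C → A z
      connected : ∀ {z} → z ∈ C → Walk (_∈ C) z r

  record IsComponent (A : Fin n → Set) (r : Fin n) (C : Subset n) : Set where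
    field
      connectedIn : ConnectedIn A r C
      closed      : ∀ {c z} → c ∈ C → c ~ z → A z → z ∈ C
    open ConnectedIn connectedIn public

  module _ {A : Fin n → Set} (A? : Decidable A) {r : Fin n} where
    private
      Frontier : Subset n → Fin n → Set
      Frontier C z = z ∉ C × A z × ∃ λ c → c ∈ C × c ~ z

      frontier? : ∀ C → Decidable (Frontier C)
      frontier? C z = ¬? (z ∈? C) ×-dec A? z ×-dec any? (λ c → (c ∈? C) ×-dec (c ~? z))

      add : ∀ {C z} → Frontier C z → ConnectedIn A r C → ConnectedIn A r (⁅ z ⁆ ∪ C)
      add {C} {z} (_ , Az , c , c∈C , c~z) C-connected = record
        { root      = C⊆C′ root
        ; ⊆A        = λ x∈C′ → [ (λ { refl → Az }) , ⊆A ] (C′-cases x∈C′)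
        ; connected = λ x∈C′ → [ (λ { refl → cons z∈C′ (~-sym c~z) (walk-map C⊆C′ (connected c∈C)) })
                               , walk-map C⊆C′ ∘ connected ] (C′-cases x∈C′) }
        where
          open ConnectedIn C-connected
          C⊆C′ : C ⊆ ⁅ z ⁆ ∪ C
          C⊆C′ = q⊆p∪q ⁅ z ⁆ C
          z∈C′ : z ∈ ⁅ z ⁆ ∪ C
          z∈C′ = x∈p∪q⁺ (inj₁ (x∈⁅x⁆ z))
          C′-cases : ∀ {x} → x ∈ ⁅ z ⁆ ∪ C → x ≡ z ⊎ x ∈ C
          C′-cases x∈C′ = Sum.map₁ (x∈⁅y⁆⇒x≡y z) (x∈p∪q⁻ ⁅ z ⁆ C x∈C′)

      grows : ∀ {C z} → Frontier C z → ∣ C ∣ < ∣ ⁅ z ⁆ ∪ C ∣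
      grows {C} {z} (z∉C , _) = p⊂q⇒∣p∣<∣q∣ (q⊆p∪q ⁅ z ⁆ C , z , x∈p∪q⁺ (inj₁ (x∈⁅x⁆ z)) , z∉C)

      grow : ∀ {C} → ConnectedIn A r C → Acc _<_ (n ∸ ∣ C ∣) → Σ (Subset n) (IsComponent A r)
      grow {C} C-connected (acc rec) with any? (frontier? C)
      ... | yes (z , z-frontier) =
            grow (add z-frontier C-connected) (rec (∸-monoʳ-< (grows z-frontier) (∣p∣≤n (⁅ z ⁆ ∪ C))))
      ... | no none = C , record { connectedIn = C-connected ; closed = closed }
        where
          closed : ∀ {c z} → c ∈ C → c ~ z → A z → z ∈ C
          closed {c} {z} c∈C c~z Az with z ∈? C
          ... | yes z∈C = z∈C
          ... | no z∉C  = contradiction (z , z∉C , Az , c , c∈C , c~z) none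

    component : A r → Σ (Subset n) (IsComponent A r)
    component Ar = grow singleton (<-wellFounded _)
      where
        singleton : ConnectedIn A r ⁅ r ⁆
        singleton = record
          { root      = x∈⁅x⁆ r
          ; ⊆A        = λ x∈⁅r⁆ → subst A (≡-sym (x∈⁅y⁆⇒x≡y r x∈⁅r⁆)) Ar
          ; connected = λ x∈⁅r⁆ → subst (λ x → Walk (_∈ ⁅ r ⁆) x r) (≡-sym (x∈⁅y⁆⇒x≡y r x∈⁅r⁆))
                                         (nil (x∈⁅x⁆ r)) }

  module Strategy (m : ℕ) (no-long-cycle : ∀ k → suc (suc m) ≤ k → ¬ InducedCycle G k) where

    copsOn : ℕ → (ℕ → Fin n) → Cops n m
    copsOn e p j = p (toℕ j ⊓ e)

    Guarded : ℕ → (ℕ → Fin n) → Fin n → Set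
    Guarded e p z = ∃ λ a → a ≤ e × (z ≡ p a ⊎ z ~ p a)

    guarded? : ∀ e p → Decidable (Guarded e p)
    guarded? e p z = anyUpTo≤? (λ a → (z ≟ᶠ p a) ⊎-dec (z ~? p a)) e

    NextTo : ℕ → (ℕ → Fin n) → Fin n → Set
    NextTo e p z = ∃ λ a → a ≤ e × z ~ p a

    nextTo? : ∀ e p → Decidable (NextTo e p)
    nextTo? e p z = anyUpTo≤? (λ a → z ~? p a) e

    nextTo⇒guarded : ∀ {e p z} → NextTo e p z → Guarded e p z
    nextTo⇒guarded (a , a≤e , z~pa) = a , a≤e , inj₂ z~pa

    OnBoundary : Subset n → Fin n → Set
    OnBoundary R z = z ∉ R × ∃ λ c → c ∈ R × c ~ z

    onBoundary? : ∀ R → Decidable (OnBoundary R)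
    onBoundary? R z = ¬? (z ∈? R) ×-dec any? (λ c → (c ∈? R) ×-dec (c ~? z))

    record CopPath (e : ℕ) (p : ℕ → Fin n) : Set where
      field
        fits          : e < m
        isInducedPath : IsInducedPath e p
      open IsInducedPath isInducedPath public

    -- R is the component of G − N[p 0, …, p e] containing the robber.
    record Territory (e : ℕ) (p : ℕ → Fin n) (R : Subset n) (r : Fin n) : Set where
      field
        robber    : r ∈ R
        reachable : Reach G (p 0) r
        unguarded : ∀ {c} → c ∈ R → ¬ Guarded e p c
        boundary  : ∀ {z} → OnBoundary R z → NextTo e p z
        connected : ∀ {c} → c ∈ R → Walk (_∈ R) c r

    territory : ∀ {e p r} → Reach G (p 0) r → ¬ Guarded e p r → Σ (Subset n) λ R → Territory e p R r
    territory {e} {p} reach free with component (¬? ∘ guarded? e p) free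
    ... | R , R-component = R , record
      { robber    = root
      ; reachable = reach
      ; unguarded = ⊆A
      ; boundary  = λ (z∉R , c , c∈R , c~z) → boundary-nextTo z∉R c∈R c~z
      ; connected = connected }
      where
        open IsComponent R-component
        boundary-nextTo : ∀ {c z} → z ∉ R → c ∈ R → c ~ z → NextTo e p z
        boundary-nextTo {c} {z} z∉R c∈R c~z with guarded? e p z
        ... | no z-free                  = contradiction (closed c∈R c~z z-free) z∉R
        ... | yes (a , a≤e , inj₁ z≡pa) = contradiction (a , a≤e , inj₂ (subst (c ~_) z≡pa c~z)) (⊆A c∈R)
        ... | yes (a , a≤e , inj₂ z~pa) = a , a≤e , z~pa

    cop-on : ∀ {e a} p → e < m → a ≤ e → ∃ λ j → copsOn e p j ≡ p a
    cop-on {e} p e<m a≤e =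
      fromℕ< (≤-<-trans a≤e e<m) , cong p (trans (cong (_⊓ e) (toℕ-fromℕ< (≤-<-trans a≤e e<m))) (m≤n⇒m⊓n≡m a≤e))

    capture : ∀ {e p r} → e < m → Guarded e p r → Caught (copsOn e p) r ⊎ CopsForce G (copsOn e p) r
    capture {e} {p} {r} e<m (a , a≤e , inj₁ r≡pa) =
      let j , j-on-pa = cop-on p e<m a≤e in inj₁ (j , trans j-on-pa (≡-sym r≡pa))
    capture {e} {p} {r} e<m (a , a≤e , inj₂ r~pa) with cop-on p e<m a≤e
    ... | j , j-on-pa = inj₂ (move (updateAt (copsOn e p) j λ _ → r) chase (inj₁ (j , updateAt-updates j (copsOn e p))))
      where
        chase : CopStep G (copsOn e p) (updateAt (copsOn e p) j λ _ → r)
        chase i with i ≟ᶠ j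
        ... | yes refl = subst (Step G (copsOn e p i)) (≡-sym (updateAt-updates i (copsOn e p)))
                               (inj₂ (subst (_~ r) (≡-sym j-on-pa) (~-sym r~pa)))
        ... | no i≢j   = inj₁ (≡-sym (updateAt-minimal i j (copsOn e p) i≢j))

    -- As the new path guards every exit of R, the robber cannot leave R.
    advance : ∀ {e p R r e′ p′} → Territory e p R r → CopPath e′ p′ →
              CopStep G (copsOn e p) (copsOn e′ p′) → Reach G (p′ 0) (p 0) →
              (∀ {z} → OnBoundary R z → Guarded e′ p′ z) →
              (∀ {R′ r′} → Territory e′ p′ R′ r′ → R′ ⊆ R → CopsForce G (copsOn e′ p′) r′) →
              CopsForce G (copsOn e p) r
    advance {e} {p} {R} {r} {e′} {p′} T P′ cops-step p′0⇝p0 guards continue =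
      move (copsOn e′ p′) cops-step (inj₂ respond)
      where
        open Territory T

        absorbs : ∀ {b a} → b ∈ R → b ~ a → ¬ Guarded e′ p′ a → a ∈ R
        absorbs {b} {a} b∈R b~a a-free with a ∈? R
        ... | yes a∈R = a∈R
        ... | no a∉R  = contradiction (guards (a∉R , b , b∈R , b~a)) a-free

        respond : ∀ r′ → Step G r r′ → Caught (copsOn e′ p′) r′ ⊎ CopsForce G (copsOn e′ p′) r′
        respond r′ r⇝r′ with guarded? e′ p′ r′
        ... | yes r′-guarded = capture (CopPath.fits P′) r′-guarded
        ... | no r′-free with territory (reach-trans p′0⇝p0 (reach-trans reachable (step⇒reach r⇝r′))) r′-free
        ...   | R′ , T′ = inj₂ (continue T′ λ c∈R′ →
                  walk-stays (λ b∈R b~a a∈R′ → absorbs b∈R b~a (Territory.unguarded T′ a∈R′))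
                             (Territory.connected T′ c∈R′)
                             ([ (λ { refl → robber }) , (λ r~r′ → absorbs robber r~r′ r′-free) ] r⇝r′))

    Winning : ℕ → ℕ → Set
    Winning F e = ∀ {p R r} → ∣ R ∣ < F → CopPath e p → Territory e p R r → CopsForce G (copsOn e p) r

    retreat : ∀ {F e p R r e′ p′} → Winning F e′ → ∣ R ∣ < F → Territory e p R r → CopPath e′ p′ →
              CopStep G (copsOn e p) (copsOn e′ p′) → Reach G (p′ 0) (p 0) →
              (∀ {z} → OnBoundary R z → NextTo e′ p′ z) → CopsForce G (copsOn e p) r
    retreat win ∣R∣<F T P′ cops-step reach covers = advance T P′ cops-step reach (nextTo⇒guarded ∘ covers)
      λ T′ R′⊆R → win (≤-<-trans (p⊆q⇒∣p∣≤∣q∣ R′⊆R) ∣R∣<F) P′ T′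

    progress : ∀ {F e p R r e′ p′ c} → Winning F e′ → ∣ R ∣ < suc F → Territory e p R r → CopPath e′ p′ →
               CopStep G (copsOn e p) (copsOn e′ p′) → Reach G (p′ 0) (p 0) →
               (∀ {z} → OnBoundary R z → Guarded e′ p′ z) → c ∈ R → Guarded e′ p′ c →
               CopsForce G (copsOn e p) r
    progress {c = c} win ∣R∣≤F T P′ cops-step reach guards c∈R c-guarded = advance T P′ cops-step reach guards
      λ T′ R′⊆R → win (<-≤-trans (p⊂q⇒∣p∣<∣q∣ (R′⊆R , c , c∈R , λ c∈R′ → Territory.unguarded T′ c∈R′ c-guarded))
                                 (s≤s⁻¹ ∣R∣≤F)) P′ T′

    extend : ∀ {F e p R r y} → Winning F (suc e) → ∣ R ∣ < suc F → CopPath e p → Territory e p R r →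
             OnBoundary R y → y ~ p e → (∀ {a} → a < e → ¬ y ~ p a) → suc e < m →
             CopsForce G (copsOn e p) r
    extend {F} {e} {p} {R} {r} {y} win ∣R∣≤F P T (_ , c , c∈R , c~y) y~pe y≁p 1+e<m =
      progress win ∣R∣≤F T P′ cops-step (subst (λ v → Reach G v (p 0)) (≡-sym (p′-≤ z≤n)) here)
               guards c∈R (suc e , ≤-refl , inj₂ (subst (c ~_) (≡-sym p′-last) c~y))
      where
        open Territory T
        p′ : ℕ → Fin n
        p′ = append e p y
        p′-≤ : ∀ {k} → k ≤ e → p′ k ≡ p k
        p′-≤ = append-≤ {e} {p} {y}
        p′-last : p′ (suc e) ≡ y
        p′-last = append-last {e} {p} {y}

        y∉p : ∀ {a} → a ≤ e → y ≢ p a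
        y∉p a≤e y≡pa = unguarded c∈R (_ , a≤e , inj₂ (subst (c ~_) y≡pa c~y))

        P′ : CopPath (suc e) p′
        P′ = record { fits = 1+e<m ; isInducedPath = append-path (CopPath.isInducedPath P) y~pe y∉p y≁p }

        cops-step : ∀ j → Step G (p (toℕ j ⊓ e)) (p′ (toℕ j ⊓ suc e))
        cops-step j with ≤-<-connex (toℕ j) e
        ... | inj₁ j≤e rewrite m≤n⇒m⊓n≡m j≤e | m≤n⇒m⊓n≡m (m≤n⇒m≤1+n j≤e) = inj₁ (≡-sym (p′-≤ j≤e))
        ... | inj₂ e<j rewrite m≥n⇒m⊓n≡n (<⇒≤ e<j) | m≥n⇒m⊓n≡n e<j =
              inj₂ (subst (p e ~_) (≡-sym p′-last) (~-sym y~pe))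

        guards : ∀ {z} → OnBoundary R z → Guarded (suc e) p′ z
        guards z-boundary with boundary z-boundary
        ... | a , a≤e , z~pa = a , m≤n⇒m≤1+n a≤e , inj₂ (subst (_ ~_) (≡-sym (p′-≤ a≤e)) z~pa)

    slide : ∀ {F p R r y} → Winning F 0 → ∣ R ∣ < suc F → CopPath 0 p → Territory 0 p R r →
            OnBoundary R y → y ~ p 0 → (∀ {z} → OnBoundary R z → z ≡ y) → CopsForce G (copsOn 0 p) r
    slide {p = p} {y = y} win ∣R∣≤F P T (_ , c , c∈R , c~y) y~p0 only-exit =
      progress win ∣R∣≤F T P′ cops-step (step here y~p0) (λ z-boundary → 0 , z≤n , inj₁ (only-exit z-boundary))
               c∈R (0 , z≤n , inj₂ c~y)
      where
        P′ : CopPath 0 (λ _ → y)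
        P′ = record { fits = CopPath.fits P ; isInducedPath = singleton-path y }

        cops-step : ∀ j → Step G (p (toℕ j ⊓ 0)) y
        cops-step j rewrite ⊓-zeroʳ (toℕ j) = inj₂ (~-sym y~p0)

    drop-first : ∀ {F e p R r} → Winning F e → ∣ R ∣ < F → CopPath (suc e) p → Territory (suc e) p R r →
                 (∀ {z} → OnBoundary R z → NextTo e (p ∘ suc) z) → CopsForce G (copsOn (suc e) p) r
    drop-first {e = e} {p} win ∣R∣<F P T covers =
      retreat win ∣R∣<F T P′ cops-step (step here (~-sym (CopPath.consecutive P z<s))) covers
      where
        P′ : CopPath e (p ∘ suc)
        P′ = record { fits = <-trans (n<1+n e) (CopPath.fits P) ; isInducedPath = tail-path (CopPath.isInducedPath P) }

        cops-step : ∀ j → Step G (p (toℕ j ⊓ suc e)) (p (suc (toℕ j ⊓ e)))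
        cops-step j with ≤-<-connex (toℕ j) e
        ... | inj₁ j≤e rewrite m≤n⇒m⊓n≡m (m≤n⇒m≤1+n j≤e) | m≤n⇒m⊓n≡m j≤e =
              inj₂ (CopPath.consecutive P (s≤s j≤e))
        ... | inj₂ e<j rewrite m≥n⇒m⊓n≡n e<j | m≥n⇒m⊓n≡n (<⇒≤ e<j) = inj₁ refl

    drop-last : ∀ {F e p R r} → Winning F e → ∣ R ∣ < F → CopPath (suc e) p → Territory (suc e) p R r →
                (∀ {z} → OnBoundary R z → NextTo e p z) → CopsForce G (copsOn (suc e) p) r
    drop-last {e = e} {p} win ∣R∣<F P T covers = retreat win ∣R∣<F T P′ cops-step here covers
      where
        P′ : CopPath e p
        P′ = record { fits = <-trans (n<1+n e) (CopPath.fits P) ; isInducedPath = init-path (CopPath.isInducedPath P) }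

        cops-step : ∀ j → Step G (p (toℕ j ⊓ suc e)) (p (toℕ j ⊓ e))
        cops-step j with ≤-<-connex (toℕ j) e
        ... | inj₁ j≤e rewrite m≤n⇒m⊓n≡m (m≤n⇒m≤1+n j≤e) | m≤n⇒m⊓n≡m j≤e = inj₁ refl
        ... | inj₂ e<j rewrite m≥n⇒m⊓n≡n e<j | m≥n⇒m⊓n≡n (<⇒≤ e<j) = inj₂ (~-sym (CopPath.consecutive P ≤-refl))

    -- An exit x at p 0 and an exit y at p e are joined through R; with m ≤ e + 1 this closes an
    -- induced cycle of length at least m + 2.
    long-cycle : ∀ {e p R r x y} → CopPath e p → Territory e p R r → m ≤ suc e →
                 OnBoundary R x → OnBoundary R y → x ≢ y →
                 x ~ p 0 → (∀ {a} → 0 < a → a ≤ e → ¬ x ~ p a) →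
                 y ~ p e → (∀ {a} → a < e → ¬ y ~ p a) → ⊥
    long-cycle {e} {p} {R} {x = x} {y} P T m≤1+e (x∉R , cx , cx∈R , cx~x) (_ , cy , cy∈R , cy~y)
               x≢y x~p0 x≁p y~pe y≁p =
      no-long-cycle (suc e + suc s) long
        (induced-cycle (CopPath.isInducedPath P) Q disjoint only-ends
                       (~-sym (subst (_~ p e) (≡-sym W.start) y~pe)) (subst (_~ p 0) (≡-sym W.end) x~p0) 0<s)
      where
        open Territory T

        shortest : Σ (WalkVia (_∈ R) y x) λ W → IsInducedPath (WalkVia.length W) (WalkVia.vertex W)
        shortest = induced-path-via (walk-via (~-sym cy~y) (walk-++ (connected cy∈R) (walk-reverse (connected cx∈R))) cx~x)
                                    (x≢y ∘ ≡-sym) x∉R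
        W : WalkVia (_∈ R) y x
        W = proj₁ shortest
        module W = WalkVia W
        s : ℕ
        s = W.length
        q : ℕ → Fin n
        q = W.vertex
        Q : IsInducedPath s q
        Q = proj₂ shortest

        0<s : 0 < s
        0<s = n≢0⇒n>0 λ s≡0 → x≢y (trans (≡-sym W.end) (trans (cong q s≡0) W.start))

        long : suc (suc m) ≤ suc e + suc s
        long = subst (_≤ suc e + suc s) (+-comm m 2) (+-mono-≤ m≤1+e (s≤s 0<s))

        data Place (b : ℕ) : Set where
          first  : q b ≡ y → b ≡ 0 → Place b
          last   : q b ≡ x → b ≡ s → Place b
          inside : q b ∈ R → Place b

        place : ∀ {b} → b ≤ s → Place b
        place {zero}  _     = first W.start refl
        place {suc b} 1+b≤s =
          [ inside ∘ W.inner z<s , (λ 1+b≡s → last (subst (λ i → q i ≡ x) (≡-sym 1+b≡s) W.end) 1+b≡s) ]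
          (m≤n⇒m<n∨m≡n 1+b≤s)

        exit-off-path : ∀ {a c z} → a ≤ e → c ∈ R → c ~ z → p a ≢ z
        exit-off-path a≤e c∈R c~z pa≡z = unguarded c∈R (_ , a≤e , inj₂ (subst (_ ~_) (≡-sym pa≡z) c~z))

        disjoint : ∀ {a b} → a ≤ e → b ≤ s → p a ≢ q b
        disjoint a≤e b≤s pa≡qb with place b≤s
        ... | first qb≡y _ = exit-off-path a≤e cy∈R cy~y (trans pa≡qb qb≡y)
        ... | last qb≡x _  = exit-off-path a≤e cx∈R cx~x (trans pa≡qb qb≡x)
        ... | inside qb∈R  = unguarded qb∈R (_ , a≤e , inj₁ (≡-sym pa≡qb))

        x-at-start : ∀ {a} → a ≤ e → x ~ p a → a ≡ 0
        x-at-start {zero}  _   _    = refl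
        x-at-start {suc a} a≤e x~pa = contradiction x~pa (x≁p z<s a≤e)

        y-at-end : ∀ {a} → a ≤ e → y ~ p a → a ≡ e
        y-at-end a≤e y~pa = [ (λ a<e → contradiction y~pa (y≁p a<e)) , id ] (m≤n⇒m<n∨m≡n a≤e)

        only-ends : ∀ {a b} → a ≤ e → b ≤ s → p a ~ q b → (a ≡ e × b ≡ 0) ⊎ (a ≡ 0 × b ≡ s)
        only-ends {a} a≤e b≤s pa~qb with place b≤s
        ... | first qb≡y b≡0 = inj₁ (y-at-end a≤e (~-sym (subst (p a ~_) qb≡y pa~qb)) , b≡0)
        ... | last qb≡x b≡s  = inj₂ (x-at-start a≤e (~-sym (subst (p a ~_) qb≡x pa~qb)) , b≡s)
        ... | inside qb∈R    = contradiction (_ , a≤e , inj₂ (~-sym pa~qb)) (unguarded qb∈R)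

    on-vertex : ∀ {F} → (∀ e → Winning F e) → Winning (suc F) 0
    on-vertex win {p} {R} {r} ∣R∣≤F P T =
      play (reach-leaves (_∈? R) reachable (λ p0∈R → unguarded p0∈R (0 , z≤n , inj₁ refl)) robber)
      where
        open Territory T

        exit-at-p0 : ∀ {z} → OnBoundary R z → z ~ p 0
        exit-at-p0 z-boundary with boundary z-boundary
        ... | a , a≤0 , z~pa = subst (λ a → _ ~ p a) (n≤0⇒n≡0 a≤0) z~pa

        play : ∃ (OnBoundary R) → CopsForce G (copsOn 0 p) r
        play (y , y-boundary) with 1 <? m
        ... | yes 1<m = extend (win 1) ∣R∣≤F P T y-boundary (exit-at-p0 y-boundary) (λ ()) 1<m
        ... | no 1≮m with any? (λ z → onBoundary? R z ×-dec ¬? (z ≟ᶠ y))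
        ...   | yes (x , x-boundary , x≢y) =
                ⊥-elim (long-cycle P T (≮⇒≥ 1≮m) x-boundary y-boundary x≢y (exit-at-p0 x-boundary)
                                   (λ 0<a a≤0 → contradiction a≤0 (<⇒≱ 0<a)) (exit-at-p0 y-boundary) (λ ()))
        ...   | no only-y = slide (win 0) ∣R∣≤F P T y-boundary (exit-at-p0 y-boundary)
                  λ {z} z-boundary → decidable-stable (z ≟ᶠ y) λ z≢y → only-y (z , z-boundary , z≢y)

    covered : ∀ {R} e p → ¬ (∃ λ z → OnBoundary R z × ¬ NextTo e p z) → ∀ {z} → OnBoundary R z → NextTo e p z
    covered e p none {z} z-boundary = decidable-stable (nextTo? e p z) λ z-far → none (z , z-boundary , z-far)

    extend-or-cycle : ∀ {F e p R r x y} → (∀ e → Winning F e) → ∣ R ∣ < suc F →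
                      CopPath (suc e) p → Territory (suc e) p R r →
                      OnBoundary R x → ¬ NextTo e (p ∘ suc) x → OnBoundary R y → ¬ NextTo e p y →
                      CopsForce G (copsOn (suc e) p) r
    extend-or-cycle {e = e} {p} win ∣R∣≤F P T x-boundary x≁tail y-boundary y≁init = decide (suc (suc e) <? m)
      where
        open Territory T

        x~p0 : _ ~ p 0
        x~p0 with boundary x-boundary
        ... | zero  , _      , x~p0 = x~p0
        ... | suc a , 1+a≤1+e , x~pa = contradiction (a , s≤s⁻¹ 1+a≤1+e , x~pa) x≁tail

        y~last : _ ~ p (suc e)
        y~last with boundary y-boundary
        ... | a , a≤1+e , y~pa with ≤-suc-cases a≤1+e
        ...   | inj₁ a≤e  = contradiction (a , a≤e , y~pa) y≁init
        ...   | inj₂ refl = y~pa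

        y≁earlier : ∀ {a} → a < suc e → ¬ _ ~ p a
        y≁earlier a<1+e y~pa = y≁init (_ , s≤s⁻¹ a<1+e , y~pa)

        decide : Dec (suc (suc e) < m) → CopsForce G (copsOn (suc e) p) _
        decide (yes fits) = extend (win (suc (suc e))) ∣R∣≤F P T y-boundary y~last y≁earlier fits
        decide (no ¬fits) = ⊥-elim (long-cycle P T (≮⇒≥ ¬fits) x-boundary y-boundary
          (λ { refl → x≁tail (e , ≤-refl , y~last) }) x~p0
          (λ { {suc a} _ 1+a≤1+e x~pa → x≁tail (a , s≤s⁻¹ 1+a≤1+e , x~pa) }) y~last y≁earlier)

    on-path : ∀ {F e} → Winning (suc F) e → (∀ e → Winning F e) → Winning (suc F) (suc e)
    on-path {e = e} win-shorter win-smaller {p} {R} ∣R∣≤F P T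
      with any? (λ z → onBoundary? R z ×-dec ¬? (nextTo? e (p ∘ suc) z))
    ... | no tail-covers = drop-first win-shorter ∣R∣≤F P T (covered e (p ∘ suc) tail-covers)
    ... | yes (x , x-boundary , x≁tail) with any? (λ z → onBoundary? R z ×-dec ¬? (nextTo? e p z))
    ...   | no init-covers = drop-last win-shorter ∣R∣≤F P T (covered e p init-covers)
    ...   | yes (y , y-boundary , y≁init) =
            extend-or-cycle win-smaller ∣R∣≤F P T x-boundary x≁tail y-boundary y≁init

    winning : ∀ F e → Winning F e
    winning zero    e       ()
    winning (suc F) zero    = on-vertex (winning F)
    winning (suc F) (suc e) = on-path (winning (suc F) e) (winning F)

    cops-win : 0 < m → ∀ v → CopsWinOnComponent G m v
    cops-win 0<m v = copsOn 0 (λ _ → v) , (λ _ → here) , respond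
      where
        respond : ∀ r → Reach G v r → Caught (copsOn 0 (λ _ → v)) r ⊎ CopsForce G (copsOn 0 (λ _ → v)) r
        respond r v⇝r with guarded? 0 (λ _ → v) r
        ... | yes r-guarded = capture 0<m r-guarded
        ... | no r-free with territory v⇝r r-free
        ...   | R , T = inj₂ (winning (suc ∣ R ∣) 0 ≤-refl (record { fits = 0<m ; isInducedPath = singleton-path v }) T)

proposition3 : (ℓ : ℕ) → 3 ≤ ℓ → (n : ℕ) → (G : Graph n) →
    (∀ k → ℓ ≤ k → ¬ InducedCycle G k) → CopNumber≤ G (ℓ ∸ 2)
proposition3 (suc (suc (suc m))) (s≤s (s≤s (s≤s _))) n G no-long-cycle v =
  suc m , s≤s z≤n , ≤-refl , Strategy.cops-win G (suc m) no-long-cycle (s≤s z≤n) v
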